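{- The graph $L\overline{L}$ is $\cap$-triangle, i.e., both $L\overline{L}$ and its complement are triangle graphs.
   Context: Let $L$ be the graph obtained from the line graph of the complete bipartite graph $K_{5,6}$ by gluing a new triangle along every edge (for each edge $uv$ add a new vertex adjacent exactly to $u$ and $v$). $L\overline{L}$ denotes the disjoint union of $L$ and its complement $\overline{L}$. A graph $G$ is triangle if for every maximal stable set $S$ and every edge $uv$ with $u,v\notin S$ there is $s\in S$ adjacent to both $u$ and $v$. -}

module Defs where

open import Data.Bool using (Bool; true; false; not; _∧_; _∨_; if_then_else_; T)
open import Data.Unit using (tt)
open import Data.Nat using (ℕ; _+_; _*_; _<ᵇ_)
open import Data.Fin using (Fin; toℕ)
import Data.Fin.Properties as FinP
open import Data.Product using (Σ; Σ-syntax; ∃; ∃-syntax; _×_; _,_; proj₁; proj₂)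
import Data.Product.Properties as ProdP
open import Data.Sum using (_⊎_; inj₁; inj₂)
import Data.Sum.Properties as SumP
open import Relation.Binary.PropositionalEquality using (_≡_; refl)
open import Relation.Binary.Definitions using (DecidableEquality)
open import Relation.Nullary using (yes; no)
open import Relation.Nullary.Decidable using (⌊_⌋)

-- Graphs: a vertex type with decidable equality and a Bool-valued
-- adjacency relation (all graphs built below are finite, simple:
-- symmetric and irreflexive adjacency).

record Graph : Set₁ where
  field
    V   : Set
    _≟_ : DecidableEquality V
    adj : V → V → Bool
open Graph public

Subset : Graph → Set
Subset G = V G → Bool

Stable : (G : Graph) → Subset G → Set
Stable G S = ∀ u v → S u ≡ true → S v ≡ true → adj G u v ≡ false

MaximalStable : (G : Graph) → Subset G → Set
MaximalStable G S =
  Stable G S ×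
  (∀ (T' : Subset G) → Stable G T' →
     (∀ u → S u ≡ true → T' u ≡ true) → ∀ u → T' u ≡ true → S u ≡ true)

IsTriangle : Graph → Set
IsTriangle G =
  ∀ (S : Subset G) → MaximalStable G S →
  ∀ u v → adj G u v ≡ true → S u ≡ false → S v ≡ false →
  Σ[ s ∈ V G ] (S s ≡ true × adj G s u ≡ true × adj G s v ≡ true)

complement : Graph → Graph
complement G = record
  { V = V G
  ; _≟_ = _≟_ G
  ; adj = λ u v → if ⌊ _≟_ G u v ⌋ then false else not (adj G u v) }

CapTriangle : Graph → Set
CapTriangle G = IsTriangle G × IsTriangle (complement G)

disjointUnion : Graph → Graph → Graph
disjointUnion G H = record
  { V = V G ⊎ V H
  ; _≟_ = SumP.≡-dec (_≟_ G) (_≟_ H)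
  ; adj = a }
  where
  a : V G ⊎ V H → V G ⊎ V H → Bool
  a (inj₁ x) (inj₁ y) = adj G x y
  a (inj₂ x) (inj₂ y) = adj H x y
  a _ _ = false

withComplement : Graph → Graph
withComplement G = disjointUnion G (complement G)

-- To get exactly one new vertex per
-- (unordered) edge {u,v}, new vertices are the pairs (u , v) with uv an
-- edge and u ≺ v for a given strict total order ≺ (Bool-valued).

T-dec : ∀ {b} → DecidableEquality (T b)
T-dec {true} tt tt = yes refl

glueTriangles : (G : Graph) → (V G → V G → Bool) → Graph
glueTriangles G lt = record
  { V = V G ⊎ NewV
  ; _≟_ = SumP.≡-dec (_≟_ G)
            (ProdP.≡-dec (ProdP.≡-dec (_≟_ G) (_≟_ G)) T-dec)
  ; adj = a }
  where
  NewV : Set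
  NewV = Σ[ p ∈ V G × V G ] T (adj G (proj₁ p) (proj₂ p) ∧ lt (proj₁ p) (proj₂ p))
  isEnd : V G → NewV → Bool
  isEnd w ((u , v) , _) = ⌊ _≟_ G w u ⌋ ∨ ⌊ _≟_ G w v ⌋
  a : V G ⊎ NewV → V G ⊎ NewV → Bool
  a (inj₁ x) (inj₁ y) = adj G x y
  a (inj₁ x) (inj₂ e) = isEnd x e
  a (inj₂ e) (inj₁ x) = isEnd x e
  a (inj₂ _) (inj₂ _) = false

-- The edges of K_{m,n} (parts Fin m, Fin n) are
-- the pairs (i , j) : Fin m × Fin n (edge i—j); two distinct edges are
-- adjacent in the line graph iff they share an endpoint.

lineGraphK : ℕ → ℕ → Graph
lineGraphK m n = record
  { V = Fin m × Fin n
  ; _≟_ = ProdP.≡-dec FinP._≟_ FinP._≟_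
  ; adj = λ { (i , j) (k , l) →
        (⌊ i FinP.≟ k ⌋ ∨ ⌊ j FinP.≟ l ⌋)
      ∧ not (⌊ i FinP.≟ k ⌋ ∧ ⌊ j FinP.≟ l ⌋) } }

-- a strict total order on Fin m × Fin n (lexicographic, via a rank)
rankLt : ∀ {m n} → Fin m × Fin n → Fin m × Fin n → Bool
rankLt {m} {n} (i , j) (k , l) = (n * toℕ i + toℕ j) <ᵇ (n * toℕ k + toℕ l)

L : Graph
L = glueTriangles (lineGraphK 5 6) rankLt

LLbar : Graph
LLbar = withComplement L

module Submission where

-- The proof works with DominatingTriangle G: every stable dominating set P
-- contains a common neighbour of each edge outside P.  For simple graphs on a
-- searchable vertex type, maximal stable sets are dominating, so this implies
-- the triangle property (dominatingTriangle⇒triangle).  The condition passes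
-- to disjoint unions (union-triangle), to joins, i.e. complements of disjoint
-- unions (join-triangle), and through double complementation.  Since the
-- complement of L L̄ is the join of L̄ and the complement of L̄ (which is L),
-- it suffices to establish the condition for L and for L̄:
--   * gluing triangles on all edges of any graph yields it (glued-triangle);
--   * so does the complement of such a glued graph, when every edge of the
--     base graph lies on a "line" of at least five points
--     (complement-glued-triangle); the rows and columns of the line graph of
--     K_{m,n} are such lines once m, n ≥ 5 (LineGraph.long-lines).

open import Defs
open import Data.Bool using (Bool; true; false; not; _∧_; _∨_; T; if_then_else_)
open import Data.Bool.Properties using (T-≡; T-∧; ¬-not; not-involutive; ∨-zeroʳ) renaming (_≟_ to _≟B_)
open import Data.Empty using (⊥; ⊥-elim)
open import Data.Unit using (tt)
open import Data.Nat using (ℕ; _<_; _+_; _*_)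
import Data.Nat.Properties as ℕP
open import Data.Fin using (Fin; zero; suc; toℕ)
open import Data.Vec using (_∷_; []; lookup)
import Data.Fin.Properties as FinP
open import Data.Product using (Σ; Σ-syntax; _×_; _,_; proj₁; proj₂)
open import Data.Sum using (_⊎_; inj₁; inj₂; [_,_])
open import Function using (_∘_; Equivalence)
open import Relation.Binary.Definitions using (DecidableEquality; tri<; tri≈; tri>)
open import Relation.Binary.PropositionalEquality using (_≡_; _≢_; refl; sym; trans; cong; subst; module ≡-Reasoning)
open import Relation.Nullary using (Dec; yes; no; ¬_)
open import Relation.Nullary.Decidable
  using (⌊_⌋; map′; ¬?; decidable-stable; _⊎-dec_; _×-dec_; isYes≗does; ⌊⌋-map′; dec-true; dec-false; toWitness)

private
  variable
    A : Set
    G H : Graph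

clash : ∀ {b} → b ≡ true → b ≡ false → A
clash refl ()

separates : (f : A → Bool) {x y : A} → f x ≡ true → f y ≡ false → x ≢ y
separates f fx fy refl = clash fx fy

⌊⌋-true : (a? : Dec A) → A → ⌊ a? ⌋ ≡ true
⌊⌋-true a? a = trans (isYes≗does a?) (dec-true a? a)

⌊⌋-false : (a? : Dec A) → ¬ A → ⌊ a? ⌋ ≡ false
⌊⌋-false a? ¬a = trans (isYes≗does a?) (dec-false a? ¬a)

witness : (a? : Dec A) → ⌊ a? ⌋ ≡ true → A
witness a? e = toWitness (Equivalence.from T-≡ e)

⌊⌋-sym : (_≟_ : DecidableEquality A) → ∀ x y → ⌊ x ≟ y ⌋ ≡ ⌊ y ≟ x ⌋
⌊⌋-sym _≟_ x y with y ≟ x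
... | yes refl = ⌊⌋-true (x ≟ x) refl
... | no y≢x = ⌊⌋-false (x ≟ y) (y≢x ∘ sym)

∧-intro : ∀ {a b} → a ≡ true → b ≡ true → T (a ∧ b)
∧-intro refl refl = tt

∨-true : ∀ {a b} → a ∨ b ≡ true → a ≡ true ⊎ b ≡ true
∨-true {true} _ = inj₁ refl
∨-true {false} e = inj₂ e

Searchable : Set → Set₁
Searchable A = (P : A → Set) → (∀ a → Dec (P a)) → Dec (Σ A P)

search-Fin : ∀ k → Searchable (Fin k)
search-Fin k P P? = FinP.any? P?

search-⊎ : ∀ {A B : Set} → Searchable A → Searchable B → Searchable (A ⊎ B)
search-⊎ {A} {B} sA sB P P? = map′ to from (sA _ (P? ∘ inj₁) ⊎-dec sB _ (P? ∘ inj₂))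
  where
  to : Σ A (P ∘ inj₁) ⊎ Σ B (P ∘ inj₂) → Σ _ P
  to (inj₁ (a , p)) = inj₁ a , p
  to (inj₂ (b , p)) = inj₂ b , p
  from : Σ _ P → Σ A (P ∘ inj₁) ⊎ Σ B (P ∘ inj₂)
  from (inj₁ a , p) = inj₁ (a , p)
  from (inj₂ b , p) = inj₂ (b , p)

search-Σ : ∀ {B : A → Set} → Searchable A → (∀ a → Searchable (B a)) → Searchable (Σ A B)
search-Σ sA sB P P? =
  map′ (λ (a , b , p) → (a , b) , p) (λ ((a , b) , p) → a , b , p)
       (sA _ λ a → sB a _ (P? ∘ (a ,_)))

search-T : ∀ b → Searchable (T b)
search-T true P P? = map′ (tt ,_) proj₂ (P? tt)
search-T false P P? = no λ { (() , _) }

not-onto : ∀ {m k} → m < k → (v : Fin m → Fin k) → ¬ (∀ j → Σ[ i ∈ Fin m ] (v i ≡ j))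
not-onto m<k v hit with i , j , i<j , same ← FinP.pigeonhole m<k (proj₁ ∘ hit) =
  FinP.<⇒≢ i<j (trans (sym (proj₂ (hit i))) (trans (cong v same) (proj₂ (hit j))))

missing : ∀ {m k} → m < k → (v : Fin m → Fin k) → Σ[ j ∈ Fin k ] (∀ i → v i ≢ j)
missing {m} {k} m<k v with FinP.any? (λ j → FinP.all? (λ i → ¬? (v i FinP.≟ j)))
... | yes found = found
... | no none = ⊥-elim (not-onto m<k v hit)
  where
  hit : ∀ j → Σ[ i ∈ Fin m ] (v i ≡ j)
  hit j with i , ¬v≢j ← FinP.¬∀⟶∃¬ m (λ i → v i ≢ j) (λ i → ¬? (v i FinP.≟ j)) (λ all → none (j , all))
    = i , decidable-stable (v i FinP.≟ j) ¬v≢j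

avoid-four : ∀ {k} → 4 < k → (a b c d : Fin k) → Σ[ j ∈ Fin k ] (j ≢ a × j ≢ b × j ≢ c × j ≢ d)
avoid-four 4<k a b c d with j , miss ← missing 4<k (lookup (a ∷ b ∷ c ∷ d ∷ [])) =
  j , (λ e → miss zero (sym e)) , (λ e → miss (suc zero) (sym e)) ,
      (λ e → miss (suc (suc zero)) (sym e)) , (λ e → miss (suc (suc (suc zero))) (sym e))

record Simple (G : Graph) : Set where
  field
    symmetric   : ∀ x y → adj G x y ≡ adj G y x
    irreflexive : ∀ x → adj G x x ≡ false
open Simple

complement-adj : ∀ G {x y} → x ≢ y → adj (complement G) x y ≡ not (adj G x y)
complement-adj G {x} {y} x≢y rewrite ⌊⌋-false (_≟_ G x y) x≢y = refl

complement-loop : ∀ G x → adj (complement G) x x ≡ false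
complement-loop G x rewrite ⌊⌋-true (_≟_ G x x) refl = refl

complement-adj-true : ∀ G {x y} → adj (complement G) x y ≡ true → x ≢ y × adj G x y ≡ false
complement-adj-true G {x} {y} e = x≢y , negated
  where
  x≢y : x ≢ y
  x≢y refl = clash e (complement-loop G x)
  negated : adj G x y ≡ false
  negated = trans (sym (not-involutive _)) (cong not (trans (sym (complement-adj G x≢y)) e))

complement-adj-intro : ∀ G {x y} → x ≢ y → adj G x y ≡ false → adj (complement G) x y ≡ true
complement-adj-intro G x≢y a = trans (complement-adj G x≢y) (cong not a)

complement-nonadj : ∀ G {x y} → x ≢ y → adj (complement G) x y ≡ false → adj G x y ≡ true
complement-nonadj G x≢y e = trans (sym (not-involutive _)) (cong not (trans (sym (complement-adj G x≢y)) e))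

adj⇒≢ : Simple G → ∀ {x y} → adj G x y ≡ true → x ≢ y
adj⇒≢ sG {x} e refl = clash e (irreflexive sG x)

simple-complement : Simple G → Simple (complement G)
simple-complement {G} sG = record { symmetric = symm ; irreflexive = complement-loop G }
  where
  symm : ∀ x y → adj (complement G) x y ≡ adj (complement G) y x
  symm x y = by-cases (_≟_ G x y)
    where
    by-cases : Dec (x ≡ y) → adj (complement G) x y ≡ adj (complement G) y x
    by-cases (yes refl) = refl
    by-cases (no x≢y) = begin
      adj (complement G) x y ≡⟨ complement-adj G x≢y ⟩
      not (adj G x y)        ≡⟨ cong not (symmetric sG x y) ⟩
      not (adj G y x)        ≡⟨ complement-adj G (x≢y ∘ sym) ⟨
      adj (complement G) y x ∎
      where open ≡-Reasoning

complement-involutive : Simple G → ∀ x y → adj (complement (complement G)) x y ≡ adj G x y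
complement-involutive {G} sG x y = by-cases (_≟_ G x y)
  where
  by-cases : Dec (x ≡ y) → adj (complement (complement G)) x y ≡ adj G x y
  by-cases (yes refl) = trans (complement-loop (complement G) x) (sym (irreflexive sG x))
  by-cases (no x≢y) = trans (complement-adj (complement G) x≢y)
                            (trans (cong not (complement-adj G x≢y)) (not-involutive _))

simple-union : Simple G → Simple H → Simple (disjointUnion G H)
simple-union {G} {H} sG sH = record { symmetric = symm ; irreflexive = irr }
  where
  symm : ∀ x y → adj (disjointUnion G H) x y ≡ adj (disjointUnion G H) y x
  symm (inj₁ x) (inj₁ y) = symmetric sG x y
  symm (inj₁ x) (inj₂ y) = refl
  symm (inj₂ x) (inj₁ y) = refl
  symm (inj₂ x) (inj₂ y) = symmetric sH x y
  irr : ∀ x → adj (disjointUnion G H) x x ≡ false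
  irr (inj₁ x) = irreflexive sG x
  irr (inj₂ x) = irreflexive sH x

join-adj₁ : ∀ G H x y → adj (complement (disjointUnion G H)) (inj₁ x) (inj₁ y) ≡ adj (complement G) x y
join-adj₁ G H x y = cong (λ b → if b then false else not (adj G x y)) (⌊⌋-map′ _ _ (_≟_ G x y))

join-adj₂ : ∀ G H x y → adj (complement (disjointUnion G H)) (inj₂ x) (inj₂ y) ≡ adj (complement H) x y
join-adj₂ G H x y = cong (λ b → if b then false else not (adj H x y)) (⌊⌋-map′ _ _ (_≟_ H x y))

Dominating : (G : Graph) → Subset G → Set
Dominating G P = ∀ w → P w ≡ false → Σ[ s ∈ V G ] (P s ≡ true × adj G s w ≡ true)

CommonNeighbour : (G : Graph) → Subset G → V G → V G → Set
CommonNeighbour G P u v = Σ[ s ∈ V G ] (P s ≡ true × adj G s u ≡ true × adj G s v ≡ true)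

swap-common : ∀ {P u v} → CommonNeighbour G P u v → CommonNeighbour G P v u
swap-common (s , Ps , su , sv) = s , Ps , sv , su

-- For simple
-- finite graphs the maximal stable sets are exactly the stable dominating
-- sets, so this is equivalent to being a triangle graph; it is the form that
-- behaves well under disjoint unions and joins.
DominatingTriangle : Graph → Set
DominatingTriangle G =
  ∀ P → Stable G P → Dominating G P →
  ∀ u v → adj G u v ≡ true → P u ≡ false → P v ≡ false → CommonNeighbour G P u v

-- A maximal stable set is dominating: a vertex with no neighbour in S could be added to S.
maximal⇒dominating : Simple G → Searchable (V G) → ∀ S → MaximalStable G S → Dominating G S
maximal⇒dominating {G} sG search S (stable , maximal) w Sw
  with search (λ s → S s ≡ true × adj G s w ≡ true) (λ s → (S s ≟B true) ×-dec (adj G s w ≟B true))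
... | yes found = found
... | no none = clash (maximal S+w stable+w included w w∈S+w) Sw
  where
  S+w : Subset G
  S+w x = S x ∨ ⌊ _≟_ G x w ⌋
  member : ∀ {x} → S+w x ≡ true → S x ≡ true ⊎ x ≡ w
  member {x} e with ∨-true {S x} e
  ... | inj₁ Sx = inj₁ Sx
  ... | inj₂ x≡w = inj₂ (witness (_≟_ G x w) x≡w)
  apart : ∀ x → S x ≡ true → adj G x w ≡ false
  apart x Sx = ¬-not λ a → none (x , Sx , a)
  stable+w : Stable G S+w
  stable+w x y ex ey with member ex | member ey
  ... | inj₁ Sx | inj₁ Sy = stable x y Sx Sy
  ... | inj₁ Sx | inj₂ refl = apart x Sx
  ... | inj₂ refl | inj₁ Sy = trans (symmetric sG w y) (apart y Sy)
  ... | inj₂ refl | inj₂ refl = irreflexive sG w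
  included : ∀ x → S x ≡ true → S+w x ≡ true
  included x Sx rewrite Sx = refl
  w∈S+w : S+w w ≡ true
  w∈S+w rewrite ⌊⌋-true (_≟_ G w w) refl = ∨-zeroʳ (S w)

dominatingTriangle⇒triangle : Simple G → Searchable (V G) → DominatingTriangle G → IsTriangle G
dominatingTriangle⇒triangle sG search triangle S maximalS =
  triangle S (proj₁ maximalS) (maximal⇒dominating sG search S maximalS)

-- The condition only depends on adjacency, so it survives double complementation.
double-complement : Simple G → DominatingTriangle G → DominatingTriangle (complement (complement G))
double-complement {G} sG triangle P stable dom u v e Pu Pv =
  back (triangle P stable' dom' u v (trans (sym (same u v)) e) Pu Pv)
  where
  same : ∀ x y → adj (complement (complement G)) x y ≡ adj G x y
  same = complement-involutive sG
  stable' : Stable G P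
  stable' x y Px Py = trans (sym (same x y)) (stable x y Px Py)
  dom' : Dominating G P
  dom' w Pw with s , Ps , sw ← dom w Pw = s , Ps , trans (sym (same s w)) sw
  back : CommonNeighbour G P u v → CommonNeighbour (complement (complement G)) P u v
  back (s , Ps , su , sv) = s , Ps , trans (same s u) su , trans (same s v) sv

-- In a disjoint union a stable dominating set restricts to one on each side,
-- and every edge lies within one side.
union-triangle : DominatingTriangle G → DominatingTriangle H → DominatingTriangle (disjointUnion G H)
union-triangle {G} {H} triangleG triangleH P stable dom = triangle
  where
  dom₁ : Dominating G (P ∘ inj₁)
  dom₁ w Pw with dom (inj₁ w) Pw
  ... | inj₁ s , Ps , sw = s , Ps , sw
  dom₂ : Dominating H (P ∘ inj₂)
  dom₂ w Pw with dom (inj₂ w) Pw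
  ... | inj₂ s , Ps , sw = s , Ps , sw
  triangle : ∀ u v → adj (disjointUnion G H) u v ≡ true → P u ≡ false → P v ≡ false →
             CommonNeighbour (disjointUnion G H) P u v
  triangle (inj₁ x) (inj₁ y) e Px Py
    with s , common ← triangleG (P ∘ inj₁) (λ a b → stable (inj₁ a) (inj₁ b)) dom₁ x y e Px Py
    = inj₁ s , common
  triangle (inj₂ x) (inj₂ y) e Px Py
    with s , common ← triangleH (P ∘ inj₂) (λ a b → stable (inj₂ a) (inj₂ b)) dom₂ x y e Px Py
    = inj₂ s , common

-- In the complement of a disjoint union every vertex of one side is adjacent to
-- every vertex of the other, so a stable set lies within one side; if it lies
-- within the side of u and v it restricts to a stable dominating set there.
join-triangle : DominatingTriangle (complement G) → DominatingTriangle (complement H) →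
                DominatingTriangle (complement (disjointUnion G H))
join-triangle {G} {H} triangleG triangleH P stable dom = triangle
  where
  J : Graph
  J = complement (disjointUnion G H)
  across : ∀ x y → P (inj₁ x) ≡ false → P (inj₂ y) ≡ false → CommonNeighbour J P (inj₁ x) (inj₂ y)
  across x y Px Py with dom (inj₁ x) Px | dom (inj₂ y) Py
  ... | inj₁ s , Ps , sx | _ = inj₁ s , Ps , sx , refl
  ... | inj₂ _ , _ , _ | inj₂ s , Ps , sy = inj₂ s , Ps , refl , sy
  ... | inj₂ s , Ps , _ | inj₁ s' , Ps' , _ with () ← stable (inj₂ s) (inj₁ s') Ps Ps'
  side₁ : ∀ c → P (inj₁ c) ≡ true → ∀ x y → adj (complement G) x y ≡ true →
          P (inj₁ x) ≡ false → P (inj₁ y) ≡ false → CommonNeighbour J P (inj₁ x) (inj₁ y)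
  side₁ c Pc x y e Px Py =
    back (triangleG (P ∘ inj₁) stable₁ dom₁ x y e Px Py)
    where
    stable₁ : Stable (complement G) (P ∘ inj₁)
    stable₁ a b Pa Pb = trans (sym (join-adj₁ G H a b)) (stable (inj₁ a) (inj₁ b) Pa Pb)
    dom₁ : Dominating (complement G) (P ∘ inj₁)
    dom₁ w Pw with dom (inj₁ w) Pw
    ... | inj₁ s , Ps , sw = s , Ps , trans (sym (join-adj₁ G H s w)) sw
    ... | inj₂ s , Ps , _ with () ← stable (inj₁ c) (inj₂ s) Pc Ps
    back : CommonNeighbour (complement G) (P ∘ inj₁) x y → CommonNeighbour J P (inj₁ x) (inj₁ y)
    back (s , Ps , sx , sy) = inj₁ s , Ps , trans (join-adj₁ G H s x) sx , trans (join-adj₁ G H s y) sy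
  side₂ : ∀ c → P (inj₂ c) ≡ true → ∀ x y → adj (complement H) x y ≡ true →
          P (inj₂ x) ≡ false → P (inj₂ y) ≡ false → CommonNeighbour J P (inj₂ x) (inj₂ y)
  side₂ c Pc x y e Px Py =
    back (triangleH (P ∘ inj₂) stable₂ dom₂ x y e Px Py)
    where
    stable₂ : Stable (complement H) (P ∘ inj₂)
    stable₂ a b Pa Pb = trans (sym (join-adj₂ G H a b)) (stable (inj₂ a) (inj₂ b) Pa Pb)
    dom₂ : Dominating (complement H) (P ∘ inj₂)
    dom₂ w Pw with dom (inj₂ w) Pw
    ... | inj₂ s , Ps , sw = s , Ps , trans (sym (join-adj₂ G H s w)) sw
    ... | inj₁ s , Ps , _ with () ← stable (inj₂ c) (inj₁ s) Pc Ps
    back : CommonNeighbour (complement H) (P ∘ inj₂) x y → CommonNeighbour J P (inj₂ x) (inj₂ y)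
    back (s , Ps , sx , sy) = inj₂ s , Ps , trans (join-adj₂ G H s x) sx , trans (join-adj₂ G H s y) sy
  triangle : ∀ u v → adj J u v ≡ true → P u ≡ false → P v ≡ false → CommonNeighbour J P u v
  triangle (inj₁ x) (inj₂ y) _ Px Py = across x y Px Py
  triangle (inj₂ x) (inj₁ y) _ Px Py = swap-common {J} (across y x Py Px)
  triangle (inj₁ x) (inj₁ y) e Px Py with dom (inj₁ x) Px
  ... | inj₂ s , Ps , _ = inj₂ s , Ps , refl , refl
  ... | inj₁ c , Pc , _ = side₁ c Pc x y (trans (sym (join-adj₁ G H x y)) e) Px Py
  triangle (inj₂ x) (inj₂ y) e Px Py with dom (inj₂ x) Px
  ... | inj₁ s , Ps , _ = inj₁ s , Ps , refl , refl
  ... | inj₂ c , Pc , _ = side₂ c Pc x y (trans (sym (join-adj₂ G H x y)) e) Px Py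

-- The rows and
-- the columns of the line graph of K_{m,n} are lines.
record Line (G : Graph) (k : ℕ) : Set where
  field
    point       : Fin k → V G
    coord       : V G → Fin k
    coord-point : ∀ a → coord (point a) ≡ a
    point-adj   : ∀ a b → a ≢ b → adj G (point a) (point b) ≡ true
    point-nbr   : ∀ a x → adj G (point a) x ≡ true → x ≡ point (coord x) ⊎ coord x ≡ a

  OnLine : V G → Set
  OnLine x = x ≡ point (coord x)

LongLinesCover : Graph → Set
LongLinesCover G =
  ∀ x y → adj G x y ≡ true → Σ[ k ∈ ℕ ] (4 < k × Σ[ ℓ ∈ Line G k ] (Line.OnLine ℓ x × Line.OnLine ℓ y))

module Glued (G : Graph) (lt : V G → V G → Bool) where

  Gl : Graph
  Gl = glueTriangles G lt

  NewVertex : Set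
  NewVertex = Σ[ p ∈ V G × V G ] T (adj G (proj₁ p) (proj₂ p) ∧ lt (proj₁ p) (proj₂ p))

  EndOf : V G → NewVertex → Set
  EndOf c ((a , b) , _) = c ≡ a ⊎ c ≡ b

  OrientsEdges : Set
  OrientsEdges = ∀ x y → adj G x y ≡ true → lt x y ≡ true ⊎ lt y x ≡ true

  end-adj : ∀ {c} t → EndOf c t → adj Gl (inj₂ t) (inj₁ c) ≡ true
  end-adj {c} ((a , b) , _) (inj₁ refl) rewrite ⌊⌋-true (_≟_ G c c) refl = refl
  end-adj {c} ((a , b) , _) (inj₂ refl) rewrite ⌊⌋-true (_≟_ G c c) refl = ∨-zeroʳ _

  adj-end : ∀ {c} t → adj Gl (inj₂ t) (inj₁ c) ≡ true → EndOf c t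
  adj-end {c} ((a , b) , _) e with ∨-true {⌊ _≟_ G c a ⌋} e
  ... | inj₁ c≡a = inj₁ (witness (_≟_ G c a) c≡a)
  ... | inj₂ c≡b = inj₂ (witness (_≟_ G c b) c≡b)

  only-ends : ∀ {p q c} t → EndOf p t → EndOf q t → p ≢ q → EndOf c t → c ≡ p ⊎ c ≡ q
  only-ends _ (inj₁ refl) (inj₁ refl) p≢q _ = ⊥-elim (p≢q refl)
  only-ends _ (inj₂ refl) (inj₂ refl) p≢q _ = ⊥-elim (p≢q refl)
  only-ends _ (inj₁ refl) (inj₂ refl) _ (inj₁ refl) = inj₁ refl
  only-ends _ (inj₁ refl) (inj₂ refl) _ (inj₂ refl) = inj₂ refl
  only-ends _ (inj₂ refl) (inj₁ refl) _ (inj₁ refl) = inj₂ refl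
  only-ends _ (inj₂ refl) (inj₁ refl) _ (inj₂ refl) = inj₁ refl

  ends-edge : ∀ a b → T (adj G a b ∧ lt a b) → adj G a b ≡ true
  ends-edge a b τ = Equivalence.to T-≡ (proj₁ (Equivalence.to T-∧ τ))

  ends-adjacent : Simple G → ∀ {c d} t → EndOf c t → EndOf d t → c ≢ d → adj G c d ≡ true
  ends-adjacent sG ((a , b) , τ) (inj₁ refl) (inj₂ refl) _ = ends-edge a b τ
  ends-adjacent sG ((a , b) , τ) (inj₂ refl) (inj₁ refl) _ = trans (symmetric sG b a) (ends-edge a b τ)
  ends-adjacent sG _ (inj₁ refl) (inj₁ refl) c≢d = ⊥-elim (c≢d refl)
  ends-adjacent sG _ (inj₂ refl) (inj₂ refl) c≢d = ⊥-elim (c≢d refl)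

  glued-over : Simple G → OrientsEdges → ∀ {x y} → adj G x y ≡ true →
               Σ[ t ∈ NewVertex ] (EndOf x t × EndOf y t)
  glued-over sG orient {x} {y} e with orient x y e
  ... | inj₁ x<y = ((x , y) , ∧-intro e x<y) , inj₁ refl , inj₂ refl
  ... | inj₂ y<x = ((y , x) , ∧-intro (trans (symmetric sG y x) e) y<x) , inj₂ refl , inj₁ refl

  simple-glued : Simple G → Simple Gl
  simple-glued sG = record { symmetric = symm ; irreflexive = irr }
    where
    symm : ∀ x y → adj Gl x y ≡ adj Gl y x
    symm (inj₁ x) (inj₁ y) = symmetric sG x y
    symm (inj₁ x) (inj₂ t) = refl
    symm (inj₂ t) (inj₁ y) = refl
    symm (inj₂ t) (inj₂ t') = refl
    irr : ∀ x → adj Gl x x ≡ false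
    irr (inj₁ x) = irreflexive sG x
    irr (inj₂ t) = refl

  search-glued : Searchable (V G) → Searchable (V Gl)
  search-glued search = search-⊎ search (search-Σ (search-Σ search λ _ → search) λ _ → search-T _)

  glued-nbrs-adjacent : Simple G → ∀ t x y → adj Gl (inj₂ t) x ≡ true → adj Gl (inj₂ t) y ≡ true →
                        x ≢ y → adj Gl x y ≡ true
  glued-nbrs-adjacent sG t (inj₁ c) (inj₁ d) tc td x≢y =
    ends-adjacent sG t (adj-end t tc) (adj-end t td) (x≢y ∘ cong inj₁)

  glued-nbrs : ∀ t {p q} → adj Gl (inj₂ t) (inj₁ p) ≡ true → adj Gl (inj₂ t) (inj₁ q) ≡ true →
               p ≢ q → ∀ w → adj Gl (inj₂ t) w ≡ true → w ≡ inj₁ p ⊎ w ≡ inj₁ q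
  glued-nbrs t tp tq p≢q (inj₁ c) tc with only-ends t (adj-end t tp) (adj-end t tq) p≢q (adj-end t tc)
  ... | inj₁ refl = inj₁ refl
  ... | inj₂ refl = inj₂ refl

  -- Gluing triangles makes every graph satisfy the triangle condition, even for
  -- dominating sets that are not stable: the new vertex on an edge outside P
  -- must be in P, since its only neighbours are the two ends; and an edge from
  -- an original vertex to a new one is covered by the other end of the new one.
  glued-triangle : Simple G → OrientsEdges → DominatingTriangle Gl
  glued-triangle sG orient P _ dom = triangle
    where
    towards-new : ∀ x t → adj Gl (inj₁ x) (inj₂ t) ≡ true → P (inj₁ x) ≡ false → P (inj₂ t) ≡ false →
                  CommonNeighbour Gl P (inj₁ x) (inj₂ t)
    towards-new x t xt Px Pt with dom (inj₂ t) Pt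
    ... | inj₁ c , Pc , ct =
      inj₁ c , Pc , ends-adjacent sG t (adj-end t ct) (adj-end t xt) (separates (P ∘ inj₁) Pc Px) , ct
    triangle : ∀ u v → adj Gl u v ≡ true → P u ≡ false → P v ≡ false → CommonNeighbour Gl P u v
    triangle (inj₁ x) (inj₁ y) xy Px Py with glued-over sG orient xy
    ... | t , x-end , y-end with P (inj₂ t) in Pt
    ...   | true = inj₂ t , Pt , end-adj t x-end , end-adj t y-end
    ...   | false with dom (inj₂ t) Pt
    ...     | inj₁ c , Pc , ct with only-ends t x-end y-end (adj⇒≢ sG xy) (adj-end t ct)
    ...       | inj₁ refl = clash Pc Px
    ...       | inj₂ refl = clash Pc Py
    triangle (inj₁ x) (inj₂ t) xt Px Pt = towards-new x t xt Px Pt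
    triangle (inj₂ t) (inj₁ x) tx Pt Px = swap-common {Gl} (towards-new x t tx Px Pt)

module GluedComplement (G : Graph) (lt : V G → V G → Bool) (sG : Simple G) where
  open Glued G lt

  Ḡl : Graph
  Ḡl = complement Gl

  sGl : Simple Gl
  sGl = simple-glued sG

  nonadj : ∀ x y → adj Ḡl x y ≡ true → adj Gl x y ≡ false
  nonadj x y e = proj₂ (complement-adj-true Gl {x} {y} e)

  clique-adj : ∀ {P} → Stable Ḡl P → ∀ {x y} → P x ≡ true → P y ≡ true → x ≢ y → adj Gl x y ≡ true
  clique-adj stable {x} {y} Px Py x≢y = complement-nonadj Gl x≢y (stable x y Px Py)

  apart-witness : ∀ {P s u z} → P u ≡ false → P z ≡ false →
                  P s ≡ true → adj Gl s u ≡ false → adj Gl s z ≡ false → CommonNeighbour Ḡl P u z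
  apart-witness {P} {s} Pu Pz Ps su sz =
    s , Ps , complement-adj-intro Gl (separates P Ps Pu) su , complement-adj-intro Gl (separates P Ps Pz) sz

  module _ {k} (ℓ : Line G k) where
    open Line ℓ

    off-line-nbrs : ∀ y → (∀ c → y ≢ inj₁ (point c)) →
                    Σ[ c₁ ∈ Fin k ] Σ[ c₂ ∈ Fin k ] (∀ a → adj Gl (inj₁ (point a)) y ≡ true → a ≡ c₁ ⊎ a ≡ c₂)
    off-line-nbrs (inj₁ x) off = coord x , coord x , nbr
      where
      nbr : ∀ a → adj G (point a) x ≡ true → a ≡ coord x ⊎ a ≡ coord x
      nbr a e with point-nbr a x e
      ... | inj₁ on = ⊥-elim (off (coord x) (cong inj₁ on))
      ... | inj₂ x-at-a = inj₁ (sym x-at-a)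
    off-line-nbrs (inj₂ t@((p , q) , _)) _ = coord p , coord q , nbr
      where
      index : ∀ {a c} → point a ≡ c → a ≡ coord c
      index {a} refl = sym (coord-point a)
      nbr : ∀ a → adj Gl (inj₁ (point a)) (inj₂ t) ≡ true → a ≡ coord p ⊎ a ≡ coord q
      nbr a e with adj-end t e
      ... | inj₁ at-p = inj₁ (index at-p)
      ... | inj₂ at-q = inj₂ (index at-q)

    apart⇒off-line : ∀ {b y} → y ≢ inj₁ (point b) → adj Gl (inj₁ (point b)) y ≡ false →
                     ∀ c → y ≢ inj₁ (point c)
    apart⇒off-line {b} y≢b apart c refl with b FinP.≟ c
    ... | yes refl = y≢b refl
    ... | no b≢c = clash (point-adj b c b≢c) apart

    avoids : ∀ y {a c₁ c₂} → (∀ a → adj Gl (inj₁ (point a)) y ≡ true → a ≡ c₁ ⊎ a ≡ c₂) →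
             a ≢ c₁ → a ≢ c₂ → adj Gl (inj₁ (point a)) y ≡ false
    avoids y {a} nbrs a≢c₁ a≢c₂ = ¬-not λ e → [ a≢c₁ , a≢c₂ ] (nbrs a e)

    -- A vertex adjacent to two points of the line but not to a third one (other
    -- than itself) is a new vertex, so these two points are all its neighbours.
    only-two-nbrs : ∀ {b₁ b₂ j} s → b₁ ≢ b₂ →
                    adj Gl s (inj₁ (point b₁)) ≡ true → adj Gl s (inj₁ (point b₂)) ≡ true →
                    s ≢ inj₁ (point j) → adj Gl s (inj₁ (point j)) ≡ false →
                    ∀ w → adj Gl s w ≡ true → w ≡ inj₁ (point b₁) ⊎ w ≡ inj₁ (point b₂)
    only-two-nbrs {b₁} {b₂} (inj₂ t) b₁≢b₂ t₁ t₂ _ _ =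
      glued-nbrs t t₁ t₂ λ e → b₁≢b₂ (trans (sym (coord-point b₁)) (trans (cong coord e) (coord-point b₂)))
    only-two-nbrs {b₁} {b₂} {j} (inj₁ x) b₁≢b₂ x₁ x₂ x≢j xj _ _ =
      ⊥-elim (on-line (point-nbr b₁ x (trans (symmetric sG _ _) x₁)) (point-nbr b₂ x (trans (symmetric sG _ _) x₂)))
      where
      at-point : ¬ OnLine x
      at-point on with coord x FinP.≟ j
      ... | yes refl = x≢j (cong inj₁ on)
      ... | no c≢j = clash (subst (λ y → adj G y (point j) ≡ true) (sym on) (point-adj (coord x) j c≢j)) xj
      on-line : OnLine x ⊎ coord x ≡ b₁ → OnLine x ⊎ coord x ≡ b₂ → ⊥
      on-line (inj₁ on) _ = at-point on
      on-line (inj₂ _) (inj₁ on) = at-point on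
      on-line (inj₂ at₁) (inj₂ at₂) = b₁≢b₂ (trans (sym at₁) at₂)

    -- Let w be a point outside P while two other points b₁, b₂ lie in P.  The
    -- vertex s of P dominating w in Ḡl is adjacent in Gl to b₁ and b₂ (P is a
    -- clique in Gl) but not to w, so its only neighbours are b₁ and b₂: it is
    -- non-adjacent in Gl to every vertex outside P.
    dominator-apart : ∀ {P} → Stable Ḡl P → ∀ {b₁ b₂ j s} → b₁ ≢ b₂ → j ≢ b₁ → j ≢ b₂ →
                      P (inj₁ (point b₁)) ≡ true → P (inj₁ (point b₂)) ≡ true →
                      P s ≡ true → adj Ḡl s (inj₁ (point j)) ≡ true →
                      ∀ y → P y ≡ false → adj Gl s y ≡ false
    dominator-apart {P} stable {b₁} {b₂} {j} {s} b₁≢b₂ j≢b₁ j≢b₂ P₁ P₂ Ps sj y Py =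
      ¬-not λ sy → [ outside P₁ , outside P₂ ] (only-two-nbrs s b₁≢b₂ (s-adj j≢b₁ P₁) (s-adj j≢b₂ P₂) s≢w s-w y sy)
      where
      s≢w : s ≢ inj₁ (point j)
      s≢w = proj₁ (complement-adj-true Gl {s} {inj₁ (point j)} sj)
      s-w : adj Gl s (inj₁ (point j)) ≡ false
      s-w = proj₂ (complement-adj-true Gl {s} {inj₁ (point j)} sj)
      s-adj : ∀ {b} → j ≢ b → P (inj₁ (point b)) ≡ true → adj Gl s (inj₁ (point b)) ≡ true
      s-adj {b} j≢b Pb = clique-adj stable Ps Pb λ s≡b →
        separates (λ v → adj Gl v (inj₁ (point j))) (point-adj b j (j≢b ∘ sym)) s-w (sym s≡b)
      outside : ∀ {b} → P (inj₁ (point b)) ≡ true → y ≢ inj₁ (point b)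
      outside Pb refl = clash Pb Py

    -- Points b₁, b₂
    -- of P with b₁ adjacent to z but not u and b₂ adjacent to u but not z force
    -- u and z off the line, so some point w avoids all their line-neighbours.
    -- Either w ∈ P, or the vertex dominating w serves (dominator-apart).
    line-witness : 4 < k → ∀ {P} → Stable Ḡl P → Dominating Ḡl P →
                   ∀ {u z s₁ s₂ b₁ b₂} → s₁ ≡ inj₁ (point b₁) → s₂ ≡ inj₁ (point b₂) →
                   P u ≡ false → P z ≡ false → P s₁ ≡ true → P s₂ ≡ true →
                   adj Gl s₁ z ≡ true → adj Gl s₁ u ≡ false → adj Gl s₂ u ≡ true → adj Gl s₂ z ≡ false →
                   CommonNeighbour Ḡl P u z
    line-witness 4<k {P} stable dom {u} {z} {b₁ = b₁} {b₂} refl refl Pu Pz P₁ P₂ s₁z s₁u s₂u s₂z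
      with c₁ , c₂ , u-nbrs ← off-line-nbrs u (apart⇒off-line (separates P P₁ Pu ∘ sym) s₁u)
         | c₃ , c₄ , z-nbrs ← off-line-nbrs z (apart⇒off-line (separates P P₂ Pz ∘ sym) s₂z)
      with j , j≢c₁ , j≢c₂ , j≢c₃ , j≢c₄ ← avoid-four 4<k c₁ c₂ c₃ c₄
      with P (inj₁ (point j)) in Pj
    ... | true = apart-witness Pu Pz Pj (avoids u u-nbrs j≢c₁ j≢c₂) (avoids z z-nbrs j≢c₃ j≢c₄)
    ... | false with s , Ps , sj ← dom (inj₁ (point j)) Pj =
      apart-witness Pu Pz Ps (apart u Pu) (apart z Pz)
      where
      apart : ∀ y → P y ≡ false → adj Gl s y ≡ false
      apart = dominator-apart stable
        (separates (λ b → adj Gl (inj₁ (point b)) z) s₁z s₂z)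
        (λ { refl → [ j≢c₃ , j≢c₄ ] (z-nbrs j s₁z) })
        (λ { refl → [ j≢c₁ , j≢c₂ ] (u-nbrs j s₂u) })
        P₁ P₂ Ps sj

  -- Members s₁, s₂ of P with s₁ ~ z, s₁ ≁ u, s₂ ~ u, s₂ ≁ z (in Gl) are adjacent,
  -- P being a clique in Gl.  Neither is new: the neighbourhood of a new vertex
  -- is a clique, which would make s₂ ~ z or s₁ ~ u.  So s₁ s₂ is an edge of G,
  -- it lies on a long line, and line-witness applies.
  crossing-pair : LongLinesCover G → ∀ {P} → Stable Ḡl P → Dominating Ḡl P →
                  ∀ {u z} → P u ≡ false → P z ≡ false → ∀ s₁ s₂ → P s₁ ≡ true → P s₂ ≡ true →
                  adj Gl s₁ z ≡ true → adj Gl s₁ u ≡ false → adj Gl s₂ u ≡ true → adj Gl s₂ z ≡ false →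
                  CommonNeighbour Ḡl P u z
  crossing-pair cover {P} stable dom {u} {z} Pu Pz s₁ s₂ P₁ P₂ s₁z s₁u s₂u s₂z
    with clique-adj stable P₁ P₂ (separates (λ s → adj Gl s z) s₁z s₂z)
  crossing-pair cover stable dom Pu Pz (inj₁ x₁) (inj₁ x₂) P₁ P₂ s₁z s₁u s₂u s₂z | x₁x₂
    with k , 4<k , ℓ , on₁ , on₂ ← cover x₁ x₂ x₁x₂ =
    line-witness ℓ 4<k stable dom (cong inj₁ on₁) (cong inj₁ on₂) Pu Pz P₁ P₂ s₁z s₁u s₂u s₂z
  crossing-pair cover {P} stable dom {u} {z} Pu Pz (inj₂ t) s₂ P₁ P₂ s₁z s₁u s₂u s₂z | ts₂ =
    clash (glued-nbrs-adjacent sG t s₂ z ts₂ s₁z (separates P P₂ Pz)) s₂z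
  crossing-pair cover {P} stable dom {u} {z} Pu Pz s₁ (inj₂ t) P₁ P₂ s₁z s₁u s₂u s₂z | s₁t =
    clash (glued-nbrs-adjacent sG t s₁ u (trans (symmetric sGl (inj₂ t) s₁) s₁t) s₂u (separates P P₁ Pu)) s₁u

  -- The complement of the glued graph satisfies the triangle condition (in fact
  -- for every pair u, z outside P, adjacent or not).  Take s₁ ∈ P dominating u
  -- and s₂ ∈ P dominating z in Ḡl; unless one of them already dominates both,
  -- they form a crossing pair.
  complement-glued-triangle : LongLinesCover G → DominatingTriangle Ḡl
  complement-glued-triangle cover P stable dom u z _ Pu Pz
    with s₁ , P₁ , s₁u ← dom u Pu | s₂ , P₂ , s₂z ← dom z Pz
    with adj Gl s₁ z in s₁z | adj Gl s₂ u in s₂u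
  ... | false | _ = apart-witness Pu Pz P₁ (nonadj s₁ u s₁u) s₁z
  ... | true | false = apart-witness Pu Pz P₂ s₂u (nonadj s₂ z s₂z)
  ... | true | true =
    crossing-pair cover stable dom Pu Pz s₁ s₂ P₁ P₂ s₁z (nonadj s₁ u s₁u) s₂u (nonadj s₂ z s₂z)

module LineGraph (m n : ℕ) where

  K : Graph
  K = lineGraphK m n

  adj-cases : ∀ {i j k l} → adj K (i , j) (k , l) ≡ true → i ≡ k ⊎ j ≡ l
  adj-cases {i} {j} {k} {l} e with i FinP.≟ k | j FinP.≟ l
  ... | yes i≡k | _ = inj₁ i≡k
  ... | no _ | yes j≡l = inj₂ j≡l

  same-row : ∀ i {j l} → j ≢ l → adj K (i , j) (i , l) ≡ true
  same-row i {j} {l} j≢l rewrite ⌊⌋-true (i FinP.≟ i) refl | ⌊⌋-false (j FinP.≟ l) j≢l = refl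

  same-column : ∀ {i k} j → i ≢ k → adj K (i , j) (k , j) ≡ true
  same-column {i} {k} j i≢k rewrite ⌊⌋-true (j FinP.≟ j) refl | ⌊⌋-false (i FinP.≟ k) i≢k = refl

  simple : Simple K
  simple = record { symmetric = symm ; irreflexive = irr }
    where
    symm : ∀ x y → adj K x y ≡ adj K y x
    symm (i , j) (k , l) rewrite ⌊⌋-sym FinP._≟_ i k | ⌊⌋-sym FinP._≟_ j l = refl
    irr : ∀ x → adj K x x ≡ false
    irr (i , j) rewrite ⌊⌋-true (i FinP.≟ i) refl | ⌊⌋-true (j FinP.≟ j) refl = refl

  search : Searchable (V K)
  search = search-Σ (search-Fin m) λ _ → search-Fin n

  row : Fin m → Line K n
  row i = record
    { point = λ j → i , j
    ; coord = proj₂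
    ; coord-point = λ _ → refl
    ; point-adj = λ _ _ → same-row i
    ; point-nbr = nbr
    }
    where
    nbr : ∀ a x → adj K (i , a) x ≡ true → x ≡ (i , proj₂ x) ⊎ proj₂ x ≡ a
    nbr a (k , l) e with adj-cases {i} {a} {k} {l} e
    ... | inj₁ refl = inj₁ refl
    ... | inj₂ refl = inj₂ refl

  column : Fin n → Line K m
  column j = record
    { point = λ i → i , j
    ; coord = proj₁
    ; coord-point = λ _ → refl
    ; point-adj = λ _ _ → same-column j
    ; point-nbr = nbr
    }
    where
    nbr : ∀ a x → adj K (a , j) x ≡ true → x ≡ (proj₁ x , j) ⊎ proj₁ x ≡ a
    nbr a (k , l) e with adj-cases {a} {j} {k} {l} e
    ... | inj₁ refl = inj₂ refl
    ... | inj₂ refl = inj₁ refl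

  long-lines : 4 < m → 4 < n → LongLinesCover K
  long-lines 4<m 4<n (i , j) (k , l) e with adj-cases {i} {j} {k} {l} e
  ... | inj₁ refl = n , 4<n , row i , refl , refl
  ... | inj₂ refl = m , 4<m , column j , refl , refl

  -- Distinct vertices have distinct ranks n·i + j, so rankLt orients every edge.
  rank : Fin m × Fin n → ℕ
  rank (i , j) = n * toℕ i + toℕ j

  rank-injective : ∀ x y → rank x ≡ rank y → x ≡ y
  rank-injective (i , j) (k , l) same
    with refl , refl ← FinP.combine-injective i j k l
           (FinP.toℕ-injective (trans (FinP.toℕ-combine i j) (trans same (sym (FinP.toℕ-combine k l)))))
    = refl

  rank-orients : Glued.OrientsEdges K rankLt
  rank-orients x@(i , j) y@(k , l) e with ℕP.<-cmp (rank x) (rank y)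
  ... | tri< x<y _ _ = inj₁ (Equivalence.to T-≡ (ℕP.<⇒<ᵇ x<y))
  ... | tri≈ _ same _ = ⊥-elim (adj⇒≢ simple e (rank-injective x y same))
  ... | tri> _ _ y<x = inj₂ (Equivalence.to T-≡ (ℕP.<⇒<ᵇ y<x))

open Glued (lineGraphK 5 6) rankLt using (simple-glued; search-glued; glued-triangle)
open GluedComplement (lineGraphK 5 6) rankLt (LineGraph.simple 5 6) using (complement-glued-triangle)

L-simple : Simple L
L-simple = simple-glued (LineGraph.simple 5 6)

L-triangle : DominatingTriangle L
L-triangle = glued-triangle (LineGraph.simple 5 6) (LineGraph.rank-orients 5 6)

L̄-triangle : DominatingTriangle (complement L)
L̄-triangle = complement-glued-triangle (LineGraph.long-lines 5 6 ℕP.≤-refl (ℕP.n≤1+n 5))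

proposition39 : CapTriangle LLbar
proposition39 =
  dominatingTriangle⇒triangle LL̄-simple search (union-triangle L-triangle L̄-triangle) ,
  dominatingTriangle⇒triangle (simple-complement LL̄-simple) search
    (join-triangle L̄-triangle (double-complement L-simple L-triangle))
  where
  LL̄-simple : Simple LLbar
  LL̄-simple = simple-union L-simple (simple-complement L-simple)
  search : Searchable (V LLbar)
  search = search-⊎ (search-glued (LineGraph.search 5 6)) (search-glued (LineGraph.search 5 6))
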